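{- For every integer $n\ge1$, $\mathrm{pk}_n(132,231,312)=\sum_{k=1}^n\frac{n!}{k!}$.
   Context: For a positive integer $n$, $[n]=\{1,\dots,n\}$. A function $f:[n]\to[n]$ is a parking function if for every $i\in[n]$, $|\{j\in[n]: f(j)\le i\}|\ge i$ (equivalently, in the usual car-parking process where car $i$ prefers spot $f(i)$ and takes the first free spot at or after it, all cars park). The parking permutation $\rho_f\in S_n$ is defined by: spot $i$ is occupied by car $\rho_f(i)$. A permutation $\pi\in S_n$ contains $\sigma\in S_m$ as a pattern if there exist $1\le i_1<\dots<i_m\le n$ with $\pi(i_a)<\pi(i_b)$ iff $\sigma(a)<\sigma(b)$ for all $a,b$; otherwise it avoids $\sigma$. $\mathrm{pk}_n(\sigma_1,\dots,\sigma_k)$ is the number of parking functions $f:[n]\to[n]$ with $\rho_f$ avoiding every $\sigma_i$. -}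

module Defs where

open import Data.Bool using (Bool; true; false; _∧_; if_then_else_)
open import Data.Nat using (ℕ; zero; suc; _+_; _≤ᵇ_; _<ᵇ_; _≡ᵇ_; _!; _/_; _≥_)
open import Data.Nat.Properties using (_!≢0)
open import Data.Fin using (Fin; toℕ)
open import Data.List using (List; []; _∷_; length; map; filter; filterᵇ; allFin; concatMap; replicate; foldl; zip; applyUpTo)
open import Data.Bool.ListAction using (all; any)
open import Data.Nat.ListAction using (sum)
open import Data.Maybe using (Maybe; just; nothing; fromMaybe)
open import Data.Product using (_×_; _,_)
open import Data.Vec using (Vec; lookup; toList)
open import Data.Vec as V using ()

-- A function f : [n] → [n] is represented by the vector (f(1),…,f(n)),
-- where the value v ∈ [n] is encoded by the element of Fin n with toℕ = v - 1.

allVecs : (n m : ℕ) → List (Vec (Fin n) m)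
allVecs n zero    = V.[] ∷ []
allVecs n (suc m) = concatMap (λ x → map (x V.∷_) (allVecs n m)) (allFin n)

-- |{ j ∈ [n] : f(j) ≤ i }|  for i ∈ [n] (i given 1-based as a natural)
countLe : ∀ {n} → Vec (Fin n) n → ℕ → ℕ
countLe {n} f i = length (filterᵇ (λ j → suc (toℕ (lookup f j)) ≤ᵇ i) (allFin n))

isParking : ∀ {n} → Vec (Fin n) n → Bool
isParking {n} f = all (λ i → i ≤ᵇ countLe f i) (applyUpTo suc n)

-- Parking process. Spots are a list of length n (0-based positions);
-- `place c p spots` parks car c at the first free spot at position ≥ p
-- (if there is none the car leaves).
place : ℕ → ℕ → List (Maybe ℕ) → List (Maybe ℕ)
place c p       []             = []
place c zero    (nothing ∷ xs) = just c ∷ xs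
place c zero    (just d ∷ xs)  = just d ∷ place c zero xs
place c (suc p) (x ∷ xs)       = x ∷ place c p xs

occupancy : ∀ {n} → Vec (Fin n) n → List (Maybe ℕ)
occupancy {n} f =
  foldl (λ spots j → place (suc (toℕ j)) (toℕ (lookup f j)) spots)
        (replicate n nothing) (allFin n)

-- The parking permutation ρ_f as the word (ρ_f(1),…,ρ_f(n)):
-- spot i is occupied by car ρ_f(i). (For a parking function every spot
-- is occupied, so the default 0 is never used.)
parkingPerm : ∀ {n} → Vec (Fin n) n → List ℕ
parkingPerm f = map (fromMaybe 0) (occupancy f)

subseqs : {A : Set} → List A → List (List A)
subseqs []       = [] ∷ []
subseqs (x ∷ xs) = map (x ∷_) (subseqs xs) Data.List.++ subseqs xs

_==_ : Bool → Bool → Bool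
true  == b = b
false == true  = false
false == false = true

orderIso : List ℕ → List ℕ → Bool
orderIso s σ =
  (length s ≡ᵇ length σ) ∧
  all (λ { (x , u) → all (λ { (y , v) → (x <ᵇ y) == (u <ᵇ v) }) (zip s σ) }) (zip s σ)

contains : List ℕ → List ℕ → Bool
contains π σ = any (λ s → orderIso s σ) (subseqs π)

avoids : List ℕ → List ℕ → Bool
avoids π σ = if contains π σ then false else true

avoidsAll : List ℕ → List (List ℕ) → Bool
avoidsAll π σs = all (avoids π) σs

pk : ℕ → List (List ℕ) → ℕ
pk n σs = length (filterᵇ (λ f → isParking f ∧ avoidsAll (parkingPerm f) σs) (allVecs n n))

sumFactQuot : ℕ → ℕ
sumFactQuot n = sum (map (λ k → _/_ (n !) (suc k !) {{suc k !≢0}}) (Data.List.upTo n))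

{-# OPTIONS --safe #-}
module Submission where

-- Write preferences and spots 0-based and let car 1 prefer spot k. If ρ_f avoids 132, 231 and 312,
-- the cars fill the spots in a fixed order: cars 1, …, k+1 take spots k, k-1, …, 0 and then car j
-- takes spot j-1, so ρ_f = (k+1, k, …, 1, k+2, …, n). Indeed, if a car i+1 ≤ k+1 prefers a spot
-- below the next one of this order, it forms a 231 with car i and the car that later fills that
-- spot; if it prefers a spot above, it parks beyond spot k and forms a 312 with the same two cars,
-- or cannot park at all when k+1 = n. A car j > k+1 preferring a spot above j-1 forms a 132 with
-- car k+1 on spot 0 and the later car on spot j-1. Conversely, these preferences park every car,
-- and every triple in (k+1, …, 1, k+2, …, n) has shape 321, 213 or 123. So cars 2, …, k+1 have one
-- admissible preference and car j > k+1 has j of them, giving n!/(k+1)! parking functions for each k.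

open import Defs
open import Data.Bool using (Bool; true; false; T; T?; _∧_; if_then_else_)
open import Data.Bool.Properties using (T-≡; T-∧)
open import Data.Empty using (⊥; ⊥-elim)
open import Data.Fin using (Fin; toℕ; zero; suc)
open import Data.Fin.Properties using (toℕ<n)
open import Data.List
  using (List; []; _∷_; _++_; length; map; filterᵇ; tabulate; allFin; concatMap; replicate; foldl; applyUpTo; upTo)
open import Data.List.Membership.Propositional using (_∈_; find; lose)
open import Data.List.Membership.Propositional.Properties using (∈-++⁺ˡ; ∈-++⁺ʳ; ∈-++⁻; ∈-map⁺; ∈-map⁻)
open import Data.List.Properties
  using (length-++; length-map; length-tabulate; length-filter; filter-++; map-tabulate; map-cong; map-upTo)
open import Data.List.Relation.Binary.Sublist.Propositional using (_⊆_; []; _∷_; _∷ʳ_; minimum)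
open import Data.List.Relation.Unary.All as All using (All; _∷_)
open import Data.List.Relation.Unary.All.Properties using (all⁺; all⁻; applyUpTo⁺₁; applyUpTo⁻; tabulate⁺)
open import Data.List.Relation.Unary.Any using (here; there)
open import Data.List.Relation.Unary.Any.Properties using (any⁺; any⁻)
open import Data.Maybe using (Maybe; just; nothing; fromMaybe)
open import Data.Nat
open import Data.Nat.DivMod using (m*n/n≡m)
open import Data.Nat.ListAction using (sum)
open import Data.Nat.Properties
open import Data.Product using (_×_; _,_; proj₁; proj₂; ∃-syntax; swap)
open import Data.Sum using (inj₁; inj₂)
open import Data.Unit using (tt)
open import Data.Vec using (Vec; lookup; _∷_)
open import Function using (_∘_; _⇔_; mk⇔; Equivalence; case_of_)
open import Relation.Binary.Definitions using (tri<; tri≈; tri>)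
open import Relation.Binary.PropositionalEquality
open import Relation.Nullary using (¬_; contradiction; yes; no)
open import Relation.Nullary.Reflects using (ofʸ; ofⁿ)

private variable A B : Set

<ᵇ-true : ∀ {m n} → m < n → (m <ᵇ n) ≡ true
<ᵇ-true m<n = Equivalence.to T-≡ (<⇒<ᵇ m<n)

<ᵇ-false : ∀ {m n} → n ≤ m → (m <ᵇ n) ≡ false
<ᵇ-false {m} {n} n≤m with m <ᵇ n | <ᵇ-reflects-< m n
... | false | _       = refl
... | true  | ofʸ m<n = contradiction n≤m (<⇒≱ m<n)

<ᵇ-irrefl : ∀ m → (m <ᵇ m) ≡ false
<ᵇ-irrefl m = <ᵇ-false (≤-refl {m})

≤ᵇ-true : ∀ {m n} → m ≤ n → (m ≤ᵇ n) ≡ true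
≤ᵇ-true m≤n = Equivalence.to T-≡ (≤⇒≤ᵇ m≤n)

≤ᵇ-false : ∀ {m n} → n < m → (m ≤ᵇ n) ≡ false
≤ᵇ-false (s≤s n≤m) = <ᵇ-false n≤m

T-ext : ∀ {a b} → (T a → T b) → (T b → T a) → a ≡ b
T-ext {false} {false} _   _   = refl
T-ext {false} {true}  _   b⇒a = ⊥-elim (b⇒a tt)
T-ext {true}  {false} a⇒b _   = ⊥-elim (a⇒b tt)
T-ext {true}  {true}  _   _   = refl

count : (A → Bool) → List A → ℕ
count p xs = length (filterᵇ p xs)

count-∷ : ∀ (p : A → Bool) x xs → count p (x ∷ xs) ≡ (if p x then suc (count p xs) else count p xs)
count-∷ p x xs with p x
... | true  = refl
... | false = refl

count-cong : ∀ {p q : A → Bool} → (∀ x → p x ≡ q x) → ∀ xs → count p xs ≡ count q xs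
count-cong p≗q [] = refl
count-cong {p = p} {q} p≗q (x ∷ xs) rewrite count-∷ p x xs | count-∷ q x xs | p≗q x with q x
... | true  = cong suc (count-cong p≗q xs)
... | false = count-cong p≗q xs

count-map : ∀ (p : B → Bool) (g : A → B) xs → count p (map g xs) ≡ count (p ∘ g) xs
count-map p g [] = refl
count-map p g (x ∷ xs) rewrite count-∷ p (g x) (map g xs) | count-∷ (p ∘ g) x xs with p (g x)
... | true  = cong suc (count-map p g xs)
... | false = count-map p g xs

count-false : ∀ (xs : List A) → count (λ _ → false) xs ≡ 0
count-false []       = refl
count-false (x ∷ xs) = count-false xs

count-const∧ : ∀ b (q : A → Bool) xs → count (λ x → b ∧ q x) xs ≡ (if b then count q xs else 0)
count-const∧ true  q xs = refl
count-const∧ false q xs = count-false xs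

count-concatMap : ∀ (p : B → Bool) (g : A → List B) xs →
  count p (concatMap g xs) ≡ sum (map (count p ∘ g) xs)
count-concatMap p g [] = refl
count-concatMap p g (x ∷ xs) = begin
  count p (g x ++ concatMap g xs)                         ≡⟨ cong length (filter-++ _ (g x) (concatMap g xs)) ⟩
  length (filterᵇ p (g x) ++ filterᵇ p (concatMap g xs)) ≡⟨ length-++ (filterᵇ p (g x)) ⟩
  count p (g x) + count p (concatMap g xs)                ≡⟨ cong (count p (g x) +_) (count-concatMap p g xs) ⟩
  sum (map (count p ∘ g) (x ∷ xs))                        ∎
  where open ≡-Reasoning

sum-indicator : ∀ (p : A → Bool) c xs → sum (map (λ x → if p x then c else 0) xs) ≡ count p xs * c
sum-indicator p c [] = refl
sum-indicator p c (x ∷ xs) rewrite count-∷ p x xs with p x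
... | true  = cong (c +_) (sum-indicator p c xs)
... | false = sum-indicator p c xs

-- Patterns in words

nth : A → List A → ℕ → A
nth d []       r       = d
nth d (x ∷ xs) zero    = x
nth d (x ∷ xs) (suc r) = nth d xs r

nth-map : ∀ (g : A → B) d xs r → nth (g d) (map g xs) r ≡ g (nth d xs r)
nth-map g d []       r       = refl
nth-map g d (x ∷ xs) zero    = refl
nth-map g d (x ∷ xs) (suc r) = nth-map g d xs r

⊆⇒∈subseqs : ∀ {s xs : List A} → s ⊆ xs → s ∈ subseqs xs
⊆⇒∈subseqs []                          = here refl
⊆⇒∈subseqs {xs = y ∷ ys} (.y ∷ʳ s⊆ys) = ∈-++⁺ʳ (map (y ∷_) (subseqs ys)) (⊆⇒∈subseqs s⊆ys)
⊆⇒∈subseqs (refl ∷ s⊆ys)              = ∈-++⁺ˡ (∈-map⁺ (_ ∷_) (⊆⇒∈subseqs s⊆ys))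

∈subseqs⇒⊆ : ∀ {s : List A} xs → s ∈ subseqs xs → s ⊆ xs
∈subseqs⇒⊆ []       (here refl) = []
∈subseqs⇒⊆ (x ∷ xs) s∈ with ∈-++⁻ (map (x ∷_) (subseqs xs)) s∈
... | inj₂ s∈′   = x ∷ʳ ∈subseqs⇒⊆ xs s∈′
... | inj₁ s∈map with ∈-map⁻ (x ∷_) s∈map
...   | t , t∈ , refl = refl ∷ ∈subseqs⇒⊆ xs t∈

at₃ : A → List A → ℕ → ℕ → ℕ → List A
at₃ d xs a b c = nth d xs a ∷ nth d xs b ∷ nth d xs c ∷ []

module _ (d : A) where

  at₁⊆ : ∀ xs {a} → a < length xs → nth d xs a ∷ [] ⊆ xs
  at₁⊆ (x ∷ xs) {zero}  _        = refl ∷ minimum xs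
  at₁⊆ (x ∷ xs) {suc a} (s≤s a<) = x ∷ʳ at₁⊆ xs a<

  at₂⊆ : ∀ xs {a b} → a < b → b < length xs → nth d xs a ∷ nth d xs b ∷ [] ⊆ xs
  at₂⊆ (x ∷ xs) {zero}  {suc b} _         (s≤s b<) = refl ∷ at₁⊆ xs b<
  at₂⊆ (x ∷ xs) {suc a} {suc b} (s≤s a<b) (s≤s b<) = x ∷ʳ at₂⊆ xs a<b b<

  at₃⊆ : ∀ xs {a b c} → a < b → b < c → c < length xs → at₃ d xs a b c ⊆ xs
  at₃⊆ (x ∷ xs) {zero}  {suc b} {suc c} _         (s≤s b<c) (s≤s c<) = refl ∷ at₂⊆ xs b<c c<
  at₃⊆ (x ∷ xs) {suc a} {suc b} {suc c} (s≤s a<b) (s≤s b<c) (s≤s c<) = x ∷ʳ at₃⊆ xs a<b b<c c<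

  ⊆⇒at₁ : ∀ {x} xs → x ∷ [] ⊆ xs → ∃[ a ] a < length xs × x ≡ nth d xs a
  ⊆⇒at₁ (y ∷ xs) (refl ∷ _) = zero , z<s , refl
  ⊆⇒at₁ (y ∷ xs) (.y ∷ʳ p) with ⊆⇒at₁ xs p
  ... | a , a< , x≡ = suc a , s≤s a< , x≡

  ⊆⇒at₂ : ∀ {x y} xs → x ∷ y ∷ [] ⊆ xs →
    ∃[ a ] ∃[ b ] a < b × b < length xs × x ≡ nth d xs a × y ≡ nth d xs b
  ⊆⇒at₂ (x ∷ xs) (refl ∷ p) with ⊆⇒at₁ xs p
  ... | b , b< , y≡ = zero , suc b , z<s , s≤s b< , refl , y≡
  ⊆⇒at₂ (x ∷ xs) (.x ∷ʳ p) with ⊆⇒at₂ xs p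
  ... | a , b , a<b , b< , x≡ , y≡ = suc a , suc b , s≤s a<b , s≤s b< , x≡ , y≡

  ⊆⇒at₃ : ∀ {x y z} xs → x ∷ y ∷ z ∷ [] ⊆ xs →
    ∃[ a ] ∃[ b ] ∃[ c ] a < b × b < c × c < length xs × x ≡ nth d xs a × y ≡ nth d xs b × z ≡ nth d xs c
  ⊆⇒at₃ (x ∷ xs) (refl ∷ p) with ⊆⇒at₂ xs p
  ... | b , c , b<c , c< , y≡ , z≡ =
    zero , suc b , suc c , z<s , s≤s b<c , s≤s c< , refl , y≡ , z≡
  ⊆⇒at₃ (x ∷ xs) (.x ∷ʳ p) with ⊆⇒at₃ xs p
  ... | a , b , c , a<b , b<c , c< , x≡ , y≡ , z≡ =
    suc a , suc b , suc c , s≤s a<b , s≤s b<c , s≤s c< , x≡ , y≡ , z≡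

record Occurrence (π σ : List ℕ) : Set where
  constructor occurrence
  field
    {a b c} : ℕ
    a<b     : a < b
    b<c     : b < c
    c<∣π∣   : c < length π
    iso     : T (orderIso (at₃ 0 π a b c) σ)

occurrence⇒contains : ∀ {π σ} → Occurrence π σ → T (contains π σ)
occurrence⇒contains {π} (occurrence a<b b<c c< iso) =
  any⁺ _ (lose (⊆⇒∈subseqs (at₃⊆ 0 π a<b b<c c<)) iso)

contains⇒occurrence : ∀ π {u v w} → T (contains π (u ∷ v ∷ w ∷ [])) → Occurrence π (u ∷ v ∷ w ∷ [])
contains⇒occurrence π {u} {v} {w} π∋σ with find (any⁻ _ (subseqs π) π∋σ)
... | s , s∈ , iso = triple s s∈ iso
  where
    triple : ∀ s → s ∈ subseqs π → T (orderIso s (u ∷ v ∷ w ∷ [])) → Occurrence π (u ∷ v ∷ w ∷ [])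
    triple (x ∷ y ∷ z ∷ []) s∈ iso with ⊆⇒at₃ 0 π (∈subseqs⇒⊆ π s∈)
    ... | a , b , c , a<b , b<c , c< , refl , refl , refl = occurrence a<b b<c c< iso
    triple []                  _ ()
    triple (_ ∷ [])            _ ()
    triple (_ ∷ _ ∷ [])        _ ()
    triple (_ ∷ _ ∷ _ ∷ _ ∷ _) _ ()

avoidsAll⇒¬contains : ∀ {π σ σs} → σ ∈ σs → T (avoidsAll π σs) → ¬ T (contains π σ)
avoidsAll⇒¬contains {π} {σ} σ∈ π-avoids = avoids⇒¬contains (All.lookup (all⁺ _ _ π-avoids) σ∈)
  where
    avoids⇒¬contains : T (avoids π σ) → ¬ T (contains π σ)
    avoids⇒¬contains with contains π σ
    ... | true  = λ ()
    ... | false = λ _ ()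

¬contains⇒avoidsAll : ∀ {π σs} → (∀ {σ} → σ ∈ σs → ¬ T (contains π σ)) → T (avoidsAll π σs)
¬contains⇒avoidsAll {π} π-avoids = all⁻ _ (All.tabulate λ σ∈ → ¬contains⇒avoids (π-avoids σ∈))
  where
    ¬contains⇒avoids : ∀ {σ} → ¬ T (contains π σ) → T (avoids π σ)
    ¬contains⇒avoids {σ} with contains π σ
    ... | true  = λ π∌σ → π∌σ tt
    ... | false = λ _ → tt

SameOrder : ℕ → ℕ → ℕ → ℕ → Set
SameOrder x y a b = (x <ᵇ y) ≡ (a <ᵇ b) × (y <ᵇ x) ≡ (b <ᵇ a)

orderIso-triple : ∀ x y z a b c → SameOrder x y a b → SameOrder x z a c → SameOrder y z b c →
  ∀ u v w → orderIso (x ∷ y ∷ z ∷ []) (u ∷ v ∷ w ∷ []) ≡ orderIso (a ∷ b ∷ c ∷ []) (u ∷ v ∷ w ∷ [])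
orderIso-triple x y z a b c (xy , yx) (xz , zx) (yz , zy) u v w
  rewrite xy | yx | xz | zx | yz | zy
        | <ᵇ-irrefl x | <ᵇ-irrefl y | <ᵇ-irrefl z | <ᵇ-irrefl a | <ᵇ-irrefl b | <ᵇ-irrefl c = refl

-- For numerals a < b, `SameOrder x y a b` computes to `SameOrder x y 0 1`.
<⇒sameOrder : ∀ {x y} → x < y → SameOrder x y 0 1
<⇒sameOrder x<y = <ᵇ-true x<y , <ᵇ-false (<⇒≤ x<y)

>⇒sameOrder : ∀ {x y} → y < x → SameOrder x y 1 0
>⇒sameOrder y<x = swap (<⇒sameOrder y<x)

module _ {x y z : ℕ} (u v w : ℕ) where

  shape-123 : x < y → y < z →
    orderIso (x ∷ y ∷ z ∷ []) (u ∷ v ∷ w ∷ []) ≡ orderIso (1 ∷ 2 ∷ 3 ∷ []) (u ∷ v ∷ w ∷ [])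
  shape-123 x<y y<z = orderIso-triple x y z 1 2 3
    (<⇒sameOrder x<y) (<⇒sameOrder (<-trans x<y y<z)) (<⇒sameOrder y<z) u v w

  shape-213 : y < x → x < z →
    orderIso (x ∷ y ∷ z ∷ []) (u ∷ v ∷ w ∷ []) ≡ orderIso (2 ∷ 1 ∷ 3 ∷ []) (u ∷ v ∷ w ∷ [])
  shape-213 y<x x<z = orderIso-triple x y z 2 1 3
    (>⇒sameOrder y<x) (<⇒sameOrder x<z) (<⇒sameOrder (<-trans y<x x<z)) u v w

  shape-321 : z < y → y < x →
    orderIso (x ∷ y ∷ z ∷ []) (u ∷ v ∷ w ∷ []) ≡ orderIso (3 ∷ 2 ∷ 1 ∷ []) (u ∷ v ∷ w ∷ [])
  shape-321 z<y y<x = orderIso-triple x y z 3 2 1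
    (>⇒sameOrder y<x) (>⇒sameOrder (<-trans z<y y<x)) (>⇒sameOrder z<y) u v w

  shape-132 : x < z → z < y →
    orderIso (x ∷ y ∷ z ∷ []) (u ∷ v ∷ w ∷ []) ≡ orderIso (1 ∷ 3 ∷ 2 ∷ []) (u ∷ v ∷ w ∷ [])
  shape-132 x<z z<y = orderIso-triple x y z 1 3 2
    (<⇒sameOrder (<-trans x<z z<y)) (<⇒sameOrder x<z) (>⇒sameOrder z<y) u v w

  shape-231 : z < x → x < y →
    orderIso (x ∷ y ∷ z ∷ []) (u ∷ v ∷ w ∷ []) ≡ orderIso (2 ∷ 3 ∷ 1 ∷ []) (u ∷ v ∷ w ∷ [])
  shape-231 z<x x<y = orderIso-triple x y z 2 3 1
    (<⇒sameOrder x<y) (>⇒sameOrder z<x) (>⇒sameOrder (<-trans z<x x<y)) u v w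

  shape-312 : y < z → z < x →
    orderIso (x ∷ y ∷ z ∷ []) (u ∷ v ∷ w ∷ []) ≡ orderIso (3 ∷ 1 ∷ 2 ∷ []) (u ∷ v ∷ w ∷ [])
  shape-312 y<z z<x = orderIso-triple x y z 3 1 2
    (>⇒sameOrder (<-trans y<z z<x)) (>⇒sameOrder z<x) (<⇒sameOrder y<z) u v w

-- The parking process

Spots : Set
Spots = List (Maybe ℕ)

occupant : Spots → ℕ → Maybe ℕ
occupant = nth nothing

empty : ℕ → Spots
empty n = replicate n nothing

parkFrom : ℕ → List ℕ → Spots → Spots
parkFrom c []       S = S
parkFrom c (p ∷ ps) S = parkFrom (suc c) ps (place c p S)

Filled : Spots → Set
Filled S = ∀ r → r < length S → occupant S r ≢ nothing

just⇒≢nothing : ∀ {m : Maybe ℕ} {d} → m ≡ just d → m ≢ nothing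
just⇒≢nothing refl ()

length-empty : ∀ n → length (empty n) ≡ n
length-empty zero    = refl
length-empty (suc n) = cong suc (length-empty n)

occupant-empty : ∀ n r → occupant (empty n) r ≡ nothing
occupant-empty zero    r       = refl
occupant-empty (suc n) zero    = refl
occupant-empty (suc n) (suc r) = occupant-empty n r

length-place : ∀ c p S → length (place c p S) ≡ length S
length-place c p       []            = refl
length-place c zero    (nothing ∷ S) = refl
length-place c zero    (just d ∷ S)  = cong suc (length-place c zero S)
length-place c (suc p) (x ∷ S)       = cong suc (length-place c p S)

length-parkFrom : ∀ c ps S → length (parkFrom c ps S) ≡ length S
length-parkFrom c []       S = refl
length-parkFrom c (p ∷ ps) S = trans (length-parkFrom (suc c) ps (place c p S)) (length-place c p S)

place-keeps : ∀ c p S r {d} → occupant S r ≡ just d → occupant (place c p S) r ≡ just d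
place-keeps c zero    (nothing ∷ S) (suc r) S[r] = S[r]
place-keeps c zero    (just e ∷ S)  zero    S[r] = S[r]
place-keeps c zero    (just e ∷ S)  (suc r) S[r] = place-keeps c zero S r S[r]
place-keeps c (suc p) (x ∷ S)       zero    S[r] = S[r]
place-keeps c (suc p) (x ∷ S)       (suc r) S[r] = place-keeps c p S r S[r]

parkFrom-keeps : ∀ c ps S r {d} → occupant S r ≡ just d → occupant (parkFrom c ps S) r ≡ just d
parkFrom-keeps c []       S r S[r] = S[r]
parkFrom-keeps c (p ∷ ps) S r S[r] = parkFrom-keeps (suc c) ps _ r (place-keeps c p S r S[r])

place-new : ∀ c p S r {d} → occupant S r ≡ nothing → occupant (place c p S) r ≡ just d → d ≡ c
place-new c zero    (nothing ∷ S) zero    _    refl  = refl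
place-new c zero    (nothing ∷ S) (suc r) S[r] S′[r] = contradiction (trans (sym S[r]) S′[r]) λ ()
place-new c zero    (just e ∷ S)  (suc r) S[r] S′[r] = place-new c zero S r S[r] S′[r]
place-new c (suc p) (x ∷ S)       zero    S[r] S′[r] = contradiction (trans (sym S[r]) S′[r]) λ ()
place-new c (suc p) (x ∷ S)       (suc r) S[r] S′[r] = place-new c p S r S[r] S′[r]

parkFrom-new : ∀ c ps S r {d} → occupant S r ≡ nothing → occupant (parkFrom c ps S) r ≡ just d → c ≤ d
parkFrom-new c []       S r S[r] S′[r] = contradiction (trans (sym S[r]) S′[r]) λ ()
parkFrom-new c (p ∷ ps) S r S[r] S′[r] with occupant (place c p S) r in T[r]
... | nothing = <⇒≤ (parkFrom-new (suc c) ps _ r T[r] S′[r])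
... | just e with place-new c p S r S[r] T[r] | trans (sym (parkFrom-keeps (suc c) ps _ r T[r])) S′[r]
...   | refl | refl = ≤-refl

filled-later : ∀ c ps S r → r < length S → occupant S r ≡ nothing → Filled (parkFrom c ps S) →
  ∃[ d ] occupant (parkFrom c ps S) r ≡ just d × c ≤ d
filled-later c ps S r r< S[r] filled with occupant (parkFrom c ps S) r in F[r]
... | nothing = contradiction F[r] (filled r (subst (r <_) (sym (length-parkFrom c ps S)) r<))
... | just d  = d , refl , parkFrom-new c ps S r S[r] F[r]

record FirstFree (S : Spots) (p q : ℕ) : Set where
  field
    p≤q    : p ≤ q
    q<∣S∣  : q < length S
    free   : occupant S q ≡ nothing
    before : ∀ r → p ≤ r → r < q → occupant S r ≢ nothing

firstFree-here : ∀ {S q} → q < length S → occupant S q ≡ nothing → FirstFree S q q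
firstFree-here q< S[q] = record
  { p≤q = ≤-refl ; q<∣S∣ = q< ; free = S[q] ; before = λ r q≤r r<q → contradiction r<q (≤⇒≯ q≤r) }

firstFree-∷ : ∀ {x S p q} → FirstFree (x ∷ S) (suc p) (suc q) → FirstFree S p q
firstFree-∷ ff = record
  { p≤q    = s≤s⁻¹ p≤q
  ; q<∣S∣  = s≤s⁻¹ q<∣S∣
  ; free   = free
  ; before = λ r p≤r r<q → before (suc r) (s≤s p≤r) (s≤s r<q)
  }
  where open FirstFree ff

firstFree-skip : ∀ {d S q} → FirstFree (just d ∷ S) 0 (suc q) → FirstFree S 0 q
firstFree-skip ff = record
  { p≤q    = z≤n
  ; q<∣S∣  = s≤s⁻¹ q<∣S∣
  ; free   = free
  ; before = λ r _ r<q → before (suc r) z≤n (s≤s r<q)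
  }
  where open FirstFree ff

module _ (c : ℕ) where
  open FirstFree

  place-lands : ∀ {p q} S → FirstFree S p q → occupant (place c p S) q ≡ just c
  place-lands {_}     {_}     []            ff = contradiction (q<∣S∣ ff) λ ()
  place-lands {zero}  {zero}  (nothing ∷ S) ff = refl
  place-lands {zero}  {zero}  (just d ∷ S)  ff = contradiction (free ff) λ ()
  place-lands {zero}  {suc q} (nothing ∷ S) ff = contradiction refl (before ff 0 z≤n z<s)
  place-lands {zero}  {suc q} (just d ∷ S)  ff = place-lands S (firstFree-skip ff)
  place-lands {suc p} {zero}  (x ∷ S)       ff = contradiction (p≤q ff) λ ()
  place-lands {suc p} {suc q} (x ∷ S)       ff = place-lands S (firstFree-∷ ff)

  place-elsewhere : ∀ {p q} S → FirstFree S p q → ∀ r → r ≢ q → occupant (place c p S) r ≡ occupant S r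
  place-elsewhere {_}     {_}     []            ff r       r≢q = refl
  place-elsewhere {zero}  {zero}  (nothing ∷ S) ff zero    r≢q = contradiction refl r≢q
  place-elsewhere {zero}  {zero}  (nothing ∷ S) ff (suc r) r≢q = refl
  place-elsewhere {zero}  {zero}  (just d ∷ S)  ff r       r≢q = contradiction (free ff) λ ()
  place-elsewhere {zero}  {suc q} (nothing ∷ S) ff r       r≢q = contradiction refl (before ff 0 z≤n z<s)
  place-elsewhere {zero}  {suc q} (just d ∷ S)  ff zero    r≢q = refl
  place-elsewhere {zero}  {suc q} (just d ∷ S)  ff (suc r) r≢q =
    place-elsewhere S (firstFree-skip ff) r (r≢q ∘ cong suc)
  place-elsewhere {suc p} {zero}  (x ∷ S)       ff r       r≢q = contradiction (p≤q ff) λ ()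
  place-elsewhere {suc p} {suc q} (x ∷ S)       ff zero    r≢q = refl
  place-elsewhere {suc p} {suc q} (x ∷ S)       ff (suc r) r≢q =
    place-elsewhere S (firstFree-∷ ff) r (r≢q ∘ cong suc)

  place-fails : ∀ p S → (∀ r → p ≤ r → r < length S → occupant S r ≢ nothing) → place c p S ≡ S
  place-fails p       []            full = refl
  place-fails zero    (nothing ∷ S) full = contradiction refl (full 0 z≤n z<s)
  place-fails zero    (just d ∷ S)  full =
    cong (just d ∷_) (place-fails zero S λ r _ r< → full (suc r) z≤n (s≤s r<))
  place-fails (suc p) (x ∷ S)       full =
    cong (x ∷_) (place-fails p S λ r p≤r r< → full (suc r) (s≤s p≤r) (s≤s r<))

-- Parking functions

occupiedBelow : ℕ → Spots → ℕ
occupiedBelow zero    S             = 0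
occupiedBelow (suc s) []            = 0
occupiedBelow (suc s) (nothing ∷ S) = occupiedBelow s S
occupiedBelow (suc s) (just _ ∷ S)  = suc (occupiedBelow s S)

prefersBelow : ℕ → List ℕ → ℕ
prefersBelow s = count (_<ᵇ s)

occupiedBelow≤ : ∀ s S → occupiedBelow s S ≤ s
occupiedBelow≤ zero    S             = z≤n
occupiedBelow≤ (suc s) []            = z≤n
occupiedBelow≤ (suc s) (nothing ∷ S) = m≤n⇒m≤1+n (occupiedBelow≤ s S)
occupiedBelow≤ (suc s) (just _ ∷ S)  = s≤s (occupiedBelow≤ s S)

occupiedBelow-filled : ∀ s S → Filled S → s ≤ length S → occupiedBelow s S ≡ s
occupiedBelow-filled zero    S             filled s≤ = refl
occupiedBelow-filled (suc s) (nothing ∷ S) filled s≤ = contradiction refl (filled 0 z<s)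
occupiedBelow-filled (suc s) (just _ ∷ S)  filled s≤ =
  cong suc (occupiedBelow-filled s S (λ r r< → filled (suc r) (s≤s r<)) (s≤s⁻¹ s≤))

occupiedBelow-empty : ∀ s n → occupiedBelow s (empty n) ≡ 0
occupiedBelow-empty zero    n       = refl
occupiedBelow-empty (suc s) zero    = refl
occupiedBelow-empty (suc s) (suc n) = occupiedBelow-empty s n

module _ (c : ℕ) where

  occupiedBelow-place-mono : ∀ p S s → occupiedBelow s S ≤ occupiedBelow s (place c p S)
  occupiedBelow-place-mono p       S             zero    = z≤n
  occupiedBelow-place-mono p       []            (suc s) = z≤n
  occupiedBelow-place-mono zero    (nothing ∷ S) (suc s) = n≤1+n _
  occupiedBelow-place-mono zero    (just _ ∷ S)  (suc s) = s≤s (occupiedBelow-place-mono zero S s)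
  occupiedBelow-place-mono (suc p) (nothing ∷ S) (suc s) = occupiedBelow-place-mono p S s
  occupiedBelow-place-mono (suc p) (just _ ∷ S)  (suc s) = s≤s (occupiedBelow-place-mono p S s)

  occupiedBelow-place-≤ : ∀ p S s → occupiedBelow s (place c p S) ≤ suc (occupiedBelow s S)
  occupiedBelow-place-≤ p       S             zero    = z≤n
  occupiedBelow-place-≤ p       []            (suc s) = z≤n
  occupiedBelow-place-≤ zero    (nothing ∷ S) (suc s) = ≤-refl
  occupiedBelow-place-≤ zero    (just _ ∷ S)  (suc s) = s≤s (occupiedBelow-place-≤ zero S s)
  occupiedBelow-place-≤ (suc p) (nothing ∷ S) (suc s) = occupiedBelow-place-≤ p S s
  occupiedBelow-place-≤ (suc p) (just _ ∷ S)  (suc s) = s≤s (occupiedBelow-place-≤ p S s)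

  occupiedBelow-place-≡ : ∀ p S s → s ≤ p → occupiedBelow s (place c p S) ≡ occupiedBelow s S
  occupiedBelow-place-≡ p       S             zero    _         = refl
  occupiedBelow-place-≡ p       []            (suc s) _         = refl
  occupiedBelow-place-≡ (suc p) (nothing ∷ S) (suc s) (s≤s s≤p) = occupiedBelow-place-≡ p S s s≤p
  occupiedBelow-place-≡ (suc p) (just _ ∷ S)  (suc s) (s≤s s≤p) = cong suc (occupiedBelow-place-≡ p S s s≤p)

  occupiedBelow-place-< : ∀ p S s → s < length S → p ≤ s → occupant (place c p S) s ≡ nothing →
    suc (occupiedBelow s S) ≤ occupiedBelow s (place c p S)
  occupiedBelow-place-< zero    (nothing ∷ S) zero    _        _         ()
  occupiedBelow-place-< zero    (nothing ∷ S) (suc s) _        _         _     = ≤-refl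
  occupiedBelow-place-< zero    (just _ ∷ S)  zero    _        _         ()
  occupiedBelow-place-< zero    (just _ ∷ S)  (suc s) (s≤s s<) _         S′[s] =
    s≤s (occupiedBelow-place-< zero S s s< z≤n S′[s])
  occupiedBelow-place-< (suc p) (nothing ∷ S) (suc s) (s≤s s<) (s≤s p≤s) S′[s] =
    occupiedBelow-place-< p S s s< p≤s S′[s]
  occupiedBelow-place-< (suc p) (just _ ∷ S)  (suc s) (s≤s s<) (s≤s p≤s) S′[s] =
    s≤s (occupiedBelow-place-< p S s s< p≤s S′[s])

occupiedBelow-parkFrom-≤ : ∀ c ps S s →
  occupiedBelow s (parkFrom c ps S) ≤ occupiedBelow s S + prefersBelow s ps
occupiedBelow-parkFrom-≤ c []       S s = ≤-reflexive (sym (+-identityʳ _))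
occupiedBelow-parkFrom-≤ c (p ∷ ps) S s with p <ᵇ s | <ᵇ-reflects-< p s
... | true  | _ = begin
  occupiedBelow s (parkFrom (suc c) ps (place c p S)) ≤⟨ occupiedBelow-parkFrom-≤ (suc c) ps _ s ⟩
  occupiedBelow s (place c p S) + prefersBelow s ps    ≤⟨ +-monoˡ-≤ _ (occupiedBelow-place-≤ c p S s) ⟩
  suc (occupiedBelow s S) + prefersBelow s ps          ≡⟨ +-suc _ _ ⟨
  occupiedBelow s S + suc (prefersBelow s ps)          ∎
  where open ≤-Reasoning
... | false | ofⁿ p≮s = begin
  occupiedBelow s (parkFrom (suc c) ps (place c p S)) ≤⟨ occupiedBelow-parkFrom-≤ (suc c) ps _ s ⟩
  occupiedBelow s (place c p S) + prefersBelow s ps    ≡⟨ cong (_+ prefersBelow s ps)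
                                                               (occupiedBelow-place-≡ c p S s (≮⇒≥ p≮s)) ⟩
  occupiedBelow s S + prefersBelow s ps                ∎
  where open ≤-Reasoning

occupiedBelow-parkFrom-≥ : ∀ c ps S s → s < length S → occupant (parkFrom c ps S) s ≡ nothing →
  prefersBelow (suc s) ps + occupiedBelow s S ≤ occupiedBelow s (parkFrom c ps S)
occupiedBelow-parkFrom-≥ c []       S s s< F[s] = ≤-refl
occupiedBelow-parkFrom-≥ c (p ∷ ps) S s s< F[s] with occupant (place c p S) s in T[s]
... | just _  = contradiction (trans (sym (parkFrom-keeps (suc c) ps _ s T[s])) F[s]) λ ()
... | nothing with p <ᵇ suc s | <ᵇ-reflects-< p (suc s)
...   | true  | ofʸ p<1+s = begin
  suc (prefersBelow (suc s) ps) + occupiedBelow s S       ≡⟨ +-suc _ _ ⟨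
  prefersBelow (suc s) ps + suc (occupiedBelow s S)       ≤⟨ +-monoʳ-≤ _ (occupiedBelow-place-< c p S s s< p≤s T[s]) ⟩
  prefersBelow (suc s) ps + occupiedBelow s (place c p S) ≤⟨ occupiedBelow-parkFrom-≥ (suc c) ps _ s s<′ F[s] ⟩
  occupiedBelow s (parkFrom (suc c) ps (place c p S))     ∎
  where open ≤-Reasoning
        s<′ = subst (s <_) (sym (length-place c p S)) s<
        p≤s = s≤s⁻¹ p<1+s
...   | false | _ = begin
  prefersBelow (suc s) ps + occupiedBelow s S             ≤⟨ +-monoʳ-≤ _ (occupiedBelow-place-mono c p S s) ⟩
  prefersBelow (suc s) ps + occupiedBelow s (place c p S) ≤⟨ occupiedBelow-parkFrom-≥ (suc c) ps _ s s<′ F[s] ⟩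
  occupiedBelow s (parkFrom (suc c) ps (place c p S))     ∎
  where open ≤-Reasoning
        s<′ = subst (s <_) (sym (length-place c p S)) s<

ParkingCondition : ℕ → List ℕ → Set
ParkingCondition n ps = ∀ i → i < n → suc i ≤ prefersBelow (suc i) ps

module _ (n c : ℕ) (ps : List ℕ) where
  private
    F = parkFrom c ps (empty n)

    length-F : length F ≡ n
    length-F = trans (length-parkFrom c ps (empty n)) (length-empty n)

  parkingCondition⇒filled : ParkingCondition n ps → Filled F
  parkingCondition⇒filled cond r r< F[r] = <-irrefl refl (begin-strict
    r                                                   <⟨ cond r (subst (r <_) length-F r<) ⟩
    prefersBelow (suc r) ps                             ≡⟨ +-identityʳ _ ⟨
    prefersBelow (suc r) ps + 0                         ≡⟨ cong (prefersBelow (suc r) ps +_) (occupiedBelow-empty r n) ⟨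
    prefersBelow (suc r) ps + occupiedBelow r (empty n) ≤⟨ occupiedBelow-parkFrom-≥ c ps (empty n) r r<′ F[r] ⟩
    occupiedBelow r F                                   ≤⟨ occupiedBelow≤ r F ⟩
    r                                                   ∎)
    where open ≤-Reasoning
          r<′ = subst (r <_) (trans length-F (sym (length-empty n))) r<

  filled⇒parkingCondition : Filled F → ParkingCondition n ps
  filled⇒parkingCondition filled i i<n = begin
    suc i                                     ≡⟨ occupiedBelow-filled (suc i) F filled (subst (suc i ≤_) (sym length-F) i<n) ⟨
    occupiedBelow (suc i) F                   ≤⟨ occupiedBelow-parkFrom-≤ c ps (empty n) (suc i) ⟩
    occupiedBelow (suc i) (empty n) + prefersBelow (suc i) ps
                                              ≡⟨ cong (_+ prefersBelow (suc i) ps) (occupiedBelow-empty (suc i) n) ⟩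
    prefersBelow (suc i) ps                   ∎
    where open ≤-Reasoning

prefs : ∀ {n m} → Vec (Fin n) m → List ℕ
prefs f = tabulate (toℕ ∘ lookup f)

module _ {n} (f : Vec (Fin n) n) where
  private
    step : Spots → Fin n → Spots
    step spots j = place (suc (toℕ j)) (toℕ (lookup f j)) spots

    foldl-step : ∀ {m} (e : Fin m → Fin n) c S → (∀ j → toℕ (e j) ≡ c + toℕ j) →
      foldl step S (tabulate e) ≡ parkFrom (suc c) (tabulate (toℕ ∘ lookup f ∘ e)) S
    foldl-step {zero}  e c S e≡ = refl
    foldl-step {suc m} e c S e≡ rewrite e≡ zero | +-identityʳ c =
      foldl-step (e ∘ suc) (suc c) _ λ j → trans (e≡ (suc j)) (+-suc c (toℕ j))

  occupancy≡parkFrom : occupancy f ≡ parkFrom 1 (prefs f) (empty n)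
  occupancy≡parkFrom = foldl-step (λ j → j) 0 (empty n) λ j → refl

  -- `suc v ≤ᵇ i` in `countLe` is `v <ᵇ i` by definition.
  countLe≡prefersBelow : ∀ i → countLe f i ≡ prefersBelow i (prefs f)
  countLe≡prefersBelow i = trans (sym (count-map (_<ᵇ i) (toℕ ∘ lookup f) (allFin n)))
                                 (cong (prefersBelow i) (map-tabulate (λ j → j) (toℕ ∘ lookup f)))

  isParking⇔parkingCondition : T (isParking f) ⇔ ParkingCondition n (prefs f)
  isParking⇔parkingCondition = mk⇔
    (λ parking i i<n → subst (suc i ≤_) (countLe≡prefersBelow (suc i))
       (≤ᵇ⇒≤ _ _ (applyUpTo⁻ suc n (all⁺ _ _ parking) i<n)))
    (λ cond → all⁻ _ (applyUpTo⁺₁ suc n λ {i} i<n →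
       ≤⇒≤ᵇ (subst (suc i ≤_) (sym (countLe≡prefersBelow (suc i))) (cond i i<n))))

-- Admissible preference sequences

permOf : Spots → List ℕ
permOf = map (fromMaybe 0)

permOf-at : ∀ F r {x} → occupant F r ≡ just x → nth 0 (permOf F) r ≡ x
permOf-at F r F[r] = trans (nth-map (fromMaybe 0) nothing F r) (cong (fromMaybe 0) F[r])

permOf-at₃ : ∀ F {a b c x y z} → occupant F a ≡ just x → occupant F b ≡ just y → occupant F c ≡ just z →
  at₃ 0 (permOf F) a b c ≡ x ∷ y ∷ z ∷ []
permOf-at₃ F {a} {b} {c} F[a] F[b] F[c] =
  cong₂ _∷_ (permOf-at F a F[a]) (cong₂ _∷_ (permOf-at F b F[b]) (cong (_∷ []) (permOf-at F c F[c])))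

forbidden : List (List ℕ)
forbidden = (1 ∷ 3 ∷ 2 ∷ []) ∷ (2 ∷ 3 ∷ 1 ∷ []) ∷ (3 ∷ 1 ∷ 2 ∷ []) ∷ []

Avoiding : Spots → Set
Avoiding F = T (avoidsAll (permOf F) forbidden)

allFrom : (ℕ → ℕ → Bool) → ℕ → List ℕ → Bool
allFrom p i []       = true
allFrom p i (v ∷ vs) = p i v ∧ allFrom p (suc i) vs

-- `allowed k i v`: when car 1 prefers spot k, car i+1 may prefer spot v (spots are 0-based).
allowed : ℕ → ℕ → ℕ → Bool
allowed k i v = if i ≤ᵇ k then v ≡ᵇ k ∸ i else v ≤ᵇ i

good : List ℕ → Bool
good []       = true
good (k ∷ vs) = allFrom (allowed k) 1 vs

module Layout (n k : ℕ) (k<n : k < n) where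

  -- The occupant of spot r once the first i cars of a good sequence have parked: car j on spot
  -- k+1-j for j ≤ i with j ≤ k+1, and car r+1 on each spot r with k < r < i.
  layout : ℕ → ℕ → Maybe ℕ
  layout i r = if r ≤ᵇ k then (if k <ᵇ r + i then just (suc (k ∸ r)) else nothing)
                         else (if r <ᵇ i then just (suc r) else nothing)

  layout-low : ∀ {i r} → r ≤ k → k < r + i → layout i r ≡ just (suc (k ∸ r))
  layout-low r≤k k< rewrite ≤ᵇ-true r≤k | <ᵇ-true k< = refl

  layout-low-free : ∀ {i r} → r + i ≤ k → layout i r ≡ nothing
  layout-low-free {i} {r} r+i≤k rewrite ≤ᵇ-true (≤-trans (m≤m+n r i) r+i≤k) | <ᵇ-false r+i≤k = refl

  layout-high : ∀ {i r} → k < r → r < i → layout i r ≡ just (suc r)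
  layout-high k<r r<i rewrite ≤ᵇ-false k<r | <ᵇ-true r<i = refl

  layout-high-free : ∀ {i r} → k < r → i ≤ r → layout i r ≡ nothing
  layout-high-free k<r i≤r rewrite ≤ᵇ-false k<r | <ᵇ-false i≤r = refl

  layout-forced-free : ∀ {i} → i ≤ k → layout i (k ∸ i) ≡ nothing
  layout-forced-free {i} i≤k = layout-low-free {i} {k ∸ i} (≤-reflexive (m∸n+n≡m i≤k))

  layout-below-forced : ∀ {i r} → i ≤ k → r < k ∸ i → layout i r ≡ nothing
  layout-below-forced {i} {r} i≤k r<q =
    layout-low-free {i} {r} (<⇒≤ (subst (r + i <_) (m∸n+n≡m i≤k) (+-monoˡ-< i r<q)))

  layout-above-forced : ∀ {i r} → i ≤ k → k ∸ i < r → r ≤ k → layout i r ≢ nothing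
  layout-above-forced {i} {r} i≤k q<r r≤k =
    just⇒≢nothing (layout-low r≤k (subst (_< r + i) (m∸n+n≡m i≤k) (+-monoˡ-< i q<r)))

  layout-previous : ∀ {i} → 1 ≤ i → i ≤ k → layout i (suc (k ∸ i)) ≡ just i
  layout-previous {suc j} _ i≤k = trans (layout-low q<k k<) (cong just value)
    where
      q = k ∸ suc j
      q<k : q < k
      q<k = ∸-monoʳ-< z<s i≤k
      k< : k < suc q + suc j
      k< = ≤-reflexive (cong suc (sym (m∸n+n≡m i≤k)))
      value : suc (k ∸ suc q) ≡ suc j
      value = cong suc (trans (sym (pred[m∸n]≡m∸[1+n] k q)) (cong pred (m∸[m∸n]≡n i≤k)))

  layout-forced-step : ∀ {i r} → i ≤ k → r ≢ k ∸ i → layout (suc i) r ≡ layout i r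
  layout-forced-step {i} {r} i≤k r≢k∸i with r ≤? k
  ... | no r≰k = trans (layout-high-free k<r (≤-trans (s≤s i≤k) k<r))
                       (sym (layout-high-free k<r (≤-trans i≤k (<⇒≤ k<r))))
    where k<r = ≰⇒> r≰k
  ... | yes r≤k with k <? r + i
  ...   | yes k<r+i = trans (layout-low r≤k (<-≤-trans k<r+i (+-monoʳ-≤ r (n≤1+n i))))
                            (sym (layout-low r≤k k<r+i))
  ...   | no k≮r+i  = trans (layout-low-free {suc i} {r} (≤-trans (≤-reflexive (+-suc r i)) r+i<k))
                            (sym (layout-low-free {i} {r} (<⇒≤ r+i<k)))
    where r+i<k = ≤∧≢⇒< (≮⇒≥ k≮r+i) λ r+i≡k →
                    r≢k∸i (trans (sym (m+n∸n≡m r i)) (cong (_∸ i) r+i≡k))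

  layout-free-step : ∀ {i r} → k < i → r ≢ i → layout (suc i) r ≡ layout i r
  layout-free-step {i} {r} k<i r≢i with r ≤? k
  ... | yes r≤k = trans (layout-low r≤k (<-≤-trans k<i (≤-trans (n≤1+n i) (m≤n+m (suc i) r))))
                        (sym (layout-low r≤k (<-≤-trans k<i (m≤n+m i r))))
  ... | no r≰k with r <? i
  ...   | yes r<i = trans (layout-high (≰⇒> r≰k) (m<n⇒m<1+n r<i)) (sym (layout-high (≰⇒> r≰k) r<i))
  ...   | no r≮i  = trans (layout-high-free (≰⇒> r≰k) i<r) (sym (layout-high-free (≰⇒> r≰k) (<⇒≤ i<r)))
    where i<r = ≤∧≢⇒< (≮⇒≥ r≮i) (r≢i ∘ sym)

  layout-forced-spot : ∀ {i} → i ≤ k → layout (suc i) (k ∸ i) ≡ just (suc i)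
  layout-forced-spot {i} i≤k = trans (layout-low (m∸n≤m k i) k<) (cong (just ∘ suc) (m∸[m∸n]≡n i≤k))
    where k< = ≤-reflexive (trans (cong suc (sym (m∸n+n≡m i≤k))) (sym (+-suc (k ∸ i) i)))

  layout-free-spot : ∀ {i} → k < i → layout (suc i) i ≡ just (suc i)
  layout-free-spot k<i = layout-high k<i ≤-refl

  layout-final : ∀ {r} → r < n → layout n r ≢ nothing
  layout-final {r} r<n with r ≤? k
  ... | yes r≤k = just⇒≢nothing (layout-low r≤k (<-≤-trans k<n (m≤n+m n r)))
  ... | no r≰k  = just⇒≢nothing (layout-high (≰⇒> r≰k) r<n)

  record LaidOut (S : Spots) (i : ℕ) : Set where
    field
      length≡   : length S ≡ n
      occupant≡ : ∀ r → occupant S r ≡ layout i r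
  open LaidOut

  laidOut-empty : LaidOut (empty n) 0
  laidOut-empty = record
    { length≡   = length-empty n
    ; occupant≡ = λ r → trans (occupant-empty n r) (sym (unoccupied r))
    }
    where
      unoccupied : ∀ r → layout 0 r ≡ nothing
      unoccupied r with r ≤? k
      ... | yes r≤k = layout-low-free {0} {r} (≤-trans (≤-reflexive (+-identityʳ r)) r≤k)
      ... | no r≰k  = layout-high-free (≰⇒> r≰k) z≤n

  laidOut-place : ∀ {S i p q} → LaidOut S i → FirstFree S p q → layout (suc i) q ≡ just (suc i) →
    (∀ r → r ≢ q → layout (suc i) r ≡ layout i r) → LaidOut (place (suc i) p S) (suc i)
  laidOut-place {S} {i} {p} {q} lo ff new old = record
    { length≡   = trans (length-place (suc i) p S) (length≡ lo)
    ; occupant≡ = λ r → case r ≟ q of λ where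
        (yes refl) → trans (place-lands (suc i) S ff) (sym new)
        (no r≢q)   → trans (place-elsewhere (suc i) S ff r r≢q) (trans (occupant≡ lo r) (sym (old r r≢q)))
    }

  laidOut-forced : ∀ {S i} → i ≤ k → LaidOut S i → LaidOut (place (suc i) (k ∸ i) S) (suc i)
  laidOut-forced {S} {i} i≤k lo = laidOut-place lo ff (layout-forced-spot i≤k) (λ r → layout-forced-step i≤k)
    where
      ff = firstFree-here (subst (k ∸ i <_) (sym (length≡ lo)) (≤-<-trans (m∸n≤m k i) k<n))
                          (trans (occupant≡ lo (k ∸ i)) (layout-forced-free i≤k))

  laidOut-free : ∀ {S i v} → k < i → i < n → v ≤ i → LaidOut S i → LaidOut (place (suc i) v S) (suc i)
  laidOut-free {S} {i} {v} k<i i<n v≤i lo = laidOut-place lo ff (layout-free-spot k<i) (λ r → layout-free-step k<i)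
    where
      below-i-occupied : ∀ r → v ≤ r → r < i → occupant S r ≢ nothing
      below-i-occupied r _ r<i with r ≤? k
      ... | yes r≤k = just⇒≢nothing (trans (occupant≡ lo r) (layout-low r≤k (<-≤-trans k<i (m≤n+m i r))))
      ... | no r≰k  = just⇒≢nothing (trans (occupant≡ lo r) (layout-high (≰⇒> r≰k) r<i))
      ff : FirstFree S v i
      ff = record
        { p≤q    = v≤i
        ; q<∣S∣  = subst (i <_) (sym (length≡ lo)) i<n
        ; free   = trans (occupant≡ lo i) (layout-high-free k<i ≤-refl)
        ; before = below-i-occupied
        }

  laidOut-allowed : ∀ {S i v} → i < n → LaidOut S i → T (allowed k i v) → LaidOut (place (suc i) v S) (suc i)
  laidOut-allowed {S} {i} {v} i<n lo allowed-v with i ≤ᵇ k | ≤ᵇ-reflects-≤ i k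
  ... | true  | ofʸ i≤k rewrite ≡ᵇ⇒≡ v (k ∸ i) allowed-v = laidOut-forced i≤k lo
  ... | false | ofⁿ i≰k = laidOut-free (≰⇒> i≰k) i<n (≤ᵇ⇒≤ v i allowed-v) lo

  laidOut-allFrom : ∀ ps i S → i + length ps ≡ n → LaidOut S i → T (allFrom (allowed k) i ps) →
    LaidOut (parkFrom (suc i) ps S) n
  laidOut-allFrom []       i S i≡n  lo _  = subst (LaidOut S) (trans (sym (+-identityʳ i)) i≡n) lo
  laidOut-allFrom (v ∷ ps) i S i+≡n lo ok =
    laidOut-allFrom ps (suc i) _ (trans (sym (+-suc i (length ps))) i+≡n)
      (laidOut-allowed (subst (i <_) i+≡n (m<m+n i z<s)) lo now) later
    where
      now   = proj₁ (Equivalence.to T-∧ ok)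
      later = proj₂ (Equivalence.to T-∧ ok)

  laidOut-filled : ∀ {F} → LaidOut F n → Filled F
  laidOut-filled lo r r< F[r] =
    layout-final (subst (r <_) (length≡ lo) r<) (trans (sym (occupant≡ lo r)) F[r])

  module _ {F} (lo : LaidOut F n) where
    private
      value-low : ∀ {r} → r ≤ k → nth 0 (permOf F) r ≡ suc (k ∸ r)
      value-low {r} r≤k =
        permOf-at F r (trans (occupant≡ lo r) (layout-low r≤k (<-≤-trans k<n (m≤n+m n r))))

      value-high : ∀ {r} → k < r → r < n → nth 0 (permOf F) r ≡ suc r
      value-high {r} k<r r<n = permOf-at F r (trans (occupant≡ lo r) (layout-high k<r r<n))

      values : ∀ σ {a b c x y z} →
        nth 0 (permOf F) a ≡ x → nth 0 (permOf F) b ≡ y → nth 0 (permOf F) c ≡ z →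
        T (orderIso (at₃ 0 (permOf F) a b c) σ) → T (orderIso (x ∷ y ∷ z ∷ []) σ)
      values σ refl refl refl iso = iso

    -- The word of the final layout is (k+1, k, …, 1, k+2, …, n).
    laidOut-triples : ∀ {u v w} → let σ = u ∷ v ∷ w ∷ [] in
      ¬ T (orderIso (3 ∷ 2 ∷ 1 ∷ []) σ) → ¬ T (orderIso (2 ∷ 1 ∷ 3 ∷ []) σ) →
      ¬ T (orderIso (1 ∷ 2 ∷ 3 ∷ []) σ) →
      ¬ T (contains (permOf F) σ)
    laidOut-triples {u} {v} {w} ¬321 ¬213 ¬123 F∋σ
      with occurrence {a} {b} {c} a<b b<c c<∣π∣ iso ← contains⇒occurrence (permOf F) F∋σ
      with c<n ← subst (c <_) (trans (length-map (fromMaybe 0) F) (length≡ lo)) c<∣π∣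
      with c ≤? k | b ≤? k | a ≤? k
    ... | yes c≤k | _ | _ =
      ¬321 (subst T (shape-321 u v w (s≤s (∸-monoʳ-< b<c c≤k)) (s≤s (∸-monoʳ-< a<b b≤k)))
                    (values (u ∷ v ∷ w ∷ []) (value-low a≤k) (value-low b≤k) (value-low c≤k) iso))
      where b≤k = ≤-trans (<⇒≤ b<c) c≤k
            a≤k = ≤-trans (<⇒≤ a<b) b≤k
    ... | no c≰k | yes b≤k | _ =
      ¬213 (subst T (shape-213 u v w (s≤s (∸-monoʳ-< a<b b≤k)) (s≤s (≤-<-trans (m∸n≤m k a) (≰⇒> c≰k))))
                    (values (u ∷ v ∷ w ∷ []) (value-low a≤k) (value-low b≤k) (value-high (≰⇒> c≰k) c<n) iso))
      where a≤k = ≤-trans (<⇒≤ a<b) b≤k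
    ... | no c≰k | no b≰k | yes a≤k =
      ¬123 (subst T (shape-123 u v w (s≤s (≤-<-trans (m∸n≤m k a) (≰⇒> b≰k))) (s≤s b<c))
                    (values (u ∷ v ∷ w ∷ []) (value-low a≤k) (value-high (≰⇒> b≰k) b<n)
                                             (value-high (≰⇒> c≰k) c<n) iso))
      where b<n = <-trans b<c c<n
    ... | no c≰k | no b≰k | no a≰k =
      ¬123 (subst T (shape-123 u v w (s≤s a<b) (s≤s b<c))
                    (values (u ∷ v ∷ w ∷ []) (value-high (≰⇒> a≰k) a<n) (value-high (≰⇒> b≰k) b<n)
                                             (value-high (≰⇒> c≰k) c<n) iso))
      where b<n = <-trans b<c c<n
            a<n = <-trans a<b b<n

    laidOut-avoiding : Avoiding F
    laidOut-avoiding = ¬contains⇒avoidsAll {permOf F} {forbidden} λ where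
      (here refl)                 → laidOut-triples (λ ()) (λ ()) (λ ())
      (there (here refl))         → laidOut-triples (λ ()) (λ ()) (λ ())
      (there (there (here refl))) → laidOut-triples (λ ()) (λ ()) (λ ())
      (there (there (there ())))

  module Deviation {i v ps S} (1≤i : 1 ≤ i) (v<n : v < n) (i+1+∣ps∣≡n : i + suc (length ps) ≡ n)
                   (lo : LaidOut S i) (occupied≤i : occupiedBelow n S ≤ i)
                   (filled : Filled (parkFrom (suc (suc i)) ps (place (suc i) v S)))
                   (avoiding : Avoiding (parkFrom (suc (suc i)) ps (place (suc i) v S))) where
    private
      F = parkFrom (suc (suc i)) ps (place (suc i) v S)

      <∣S∣ : ∀ {r} → r < n → r < length S
      <∣S∣ {r} = subst (r <_) (sym (length≡ lo))

      i<n : i < n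
      i<n = subst (i <_) i+1+∣ps∣≡n (m<m+n i z<s)

      length-F : length F ≡ n
      length-F = trans (length-parkFrom _ ps _) (trans (length-place (suc i) v S) (length≡ lo))

      free-here : ∀ {r} → r < n → layout i r ≡ nothing → FirstFree S r r
      free-here r<n L[r] = firstFree-here (<∣S∣ r<n) (trans (occupant≡ lo _) L[r])

      lands : ∀ {Q} → FirstFree S v Q → occupant F Q ≡ just (suc i)
      lands ff = parkFrom-keeps _ ps _ _ (place-lands (suc i) S ff)

      stays : ∀ {r d} → layout i r ≡ just d → occupant F r ≡ just d
      stays {r} L[r] = parkFrom-keeps _ ps _ r (place-keeps (suc i) v S r (trans (occupant≡ lo r) L[r]))

      later : ∀ {Q r} → FirstFree S v Q → r ≢ Q → r < n → layout i r ≡ nothing →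
        ∃[ d ] occupant F r ≡ just d × suc (suc i) ≤ d
      later {Q} {r} ff r≢Q r<n L[r] =
        filled-later _ ps _ r (subst (r <_) (sym (length-place (suc i) v S)) (<∣S∣ r<n))
          (trans (place-elsewhere (suc i) S ff r r≢Q) (trans (occupant≡ lo r) L[r])) filled

      forbidden-at : ∀ {σ a b c x y z} → σ ∈ forbidden → a < b → b < c → c < n →
        occupant F a ≡ just x → occupant F b ≡ just y → occupant F c ≡ just z →
        ¬ T (orderIso (x ∷ y ∷ z ∷ []) σ)
      forbidden-at {σ} σ∈ a<b b<c c<n F[a] F[b] F[c] iso =
        avoidsAll⇒¬contains {permOf F} σ∈ avoiding (occurrence⇒contains {permOf F} {σ}
          (occurrence a<b b<c c<∣π∣ (subst (λ t → T (orderIso t σ)) (sym (permOf-at₃ F F[a] F[b] F[c])) iso)))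
        where c<∣π∣ = subst (_ <_) (sym (trans (length-map _ F) length-F)) c<n

      forced<n : i ≤ k → k ∸ i < n
      forced<n i≤k = ≤-<-trans (m∸n≤m k i) k<n

      occupied-above : i ≤ k → k ∸ i < v → ∀ r → v ≤ r → r ≤ k → occupant S r ≢ nothing
      occupied-above i≤k q<v r v≤r r≤k S[r] =
        layout-above-forced i≤k (<-≤-trans q<v v≤r) r≤k (trans (sym (occupant≡ lo r)) S[r])

    too-low : i ≤ k → v < k ∸ i → ⊥
    too-low i≤k v<q =
      let d , F[q] , i+2≤d = later ff (λ q≡v → <-irrefl (sym q≡v) v<q) (forced<n i≤k) (layout-forced-free i≤k)
      in forbidden-at (there (here refl)) v<q (n<1+n _) (≤-<-trans (∸-monoʳ-< 1≤i i≤k) k<n)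
           (lands ff) F[q] (stays (layout-previous 1≤i i≤k)) (subst T (sym (shape-231 2 3 1 (n<1+n i) i+2≤d)) tt)
      where ff = free-here v<n (layout-below-forced i≤k v<q)

    -- Car i+1 cannot park at all, so the remaining cars are too few to fill the free spots.
    overflow : i ≤ k → k ∸ i < v → v ≤ k → n ≡ suc k → ⊥
    overflow i≤k q<v v≤k n≡1+k = <-irrefl refl (begin-strict
      n                                       ≡⟨ occupiedBelow-filled n F filled (≤-reflexive (sym length-F)) ⟨
      occupiedBelow n F                       ≤⟨ occupiedBelow-parkFrom-≤ _ ps _ n ⟩
      occupiedBelow n (place (suc i) v S) + prefersBelow n ps
                                              ≡⟨ cong (λ S′ → occupiedBelow n S′ + prefersBelow n ps) fails ⟩
      occupiedBelow n S + prefersBelow n ps   ≤⟨ +-mono-≤ occupied≤i (length-filter (T? ∘ (_<ᵇ n)) ps) ⟩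
      i + length ps                           <⟨ +-monoʳ-< i (n<1+n _) ⟩
      i + suc (length ps)                     ≡⟨ i+1+∣ps∣≡n ⟩
      n                                       ∎)
      where
        open ≤-Reasoning
        fails : place (suc i) v S ≡ S
        fails = place-fails (suc i) v S λ r v≤r r< →
          occupied-above i≤k q<v r v≤r (s≤s⁻¹ (subst (r <_) (trans (length≡ lo) n≡1+k) r<))

    beyond : i ≤ k → ∀ {Q} → k < Q → FirstFree S v Q → ⊥
    beyond i≤k {Q} k<Q ff =
      let d , F[q] , i+2≤d = later ff (λ q≡Q → <-irrefl q≡Q (≤-<-trans (m∸n≤m k i) k<Q)) (forced<n i≤k)
                                   (layout-forced-free i≤k)
      in forbidden-at (there (there (here refl))) (n<1+n _) (≤-<-trans (∸-monoʳ-< 1≤i i≤k) k<Q) Q<n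
           F[q] (stays (layout-previous 1≤i i≤k)) (lands ff) (subst T (sym (shape-312 3 1 2 (n<1+n i) i+2≤d)) tt)
      where Q<n = subst (Q <_) (length≡ lo) (FirstFree.q<∣S∣ ff)

    too-high : i ≤ k → k ∸ i < v → ⊥
    too-high i≤k q<v with k <? v
    ... | yes k<v = beyond i≤k k<v (free-here v<n (layout-high-free k<v (≤-trans i≤k (<⇒≤ k<v))))
    ... | no k≮v with suc k <? n
    ...   | yes k+1<n = beyond i≤k (n<1+n k) record
      { p≤q    = m≤n⇒m≤1+n (≮⇒≥ k≮v)
      ; q<∣S∣  = <∣S∣ k+1<n
      ; free   = trans (occupant≡ lo _) (layout-high-free (n<1+n k) (m≤n⇒m≤1+n i≤k))
      ; before = λ r v≤r r≤k → occupied-above i≤k q<v r v≤r (s≤s⁻¹ r≤k)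
      }
    ...   | no k+1≮n = overflow i≤k q<v (≮⇒≥ k≮v) (≤-antisym (≮⇒≥ k+1≮n) k<n)

    too-far : k < i → i < v → ⊥
    too-far k<i i<v =
      let d , F[i] , i+2≤d = later ff (λ i≡v → <-irrefl i≡v i<v) i<n (layout-high-free k<i ≤-refl)
      in forbidden-at (here refl) 1≤i i<v v<n (stays (layout-low z≤n k<i)) F[i] (lands ff)
           (subst T (sym (shape-132 1 3 2 (s≤s k<i) i+2≤d)) tt)
      where ff = free-here v<n (layout-high-free (<-trans k<i i<v) (<⇒≤ i<v))

    allowed-next : T (allowed k i v)
    allowed-next with i ≤ᵇ k | ≤ᵇ-reflects-≤ i k
    ... | true | ofʸ i≤k with <-cmp v (k ∸ i)
    ...   | tri< v<q _ _ = ⊥-elim (too-low i≤k v<q)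
    ...   | tri≈ _ v≡q _ = ≡⇒≡ᵇ v (k ∸ i) v≡q
    ...   | tri> _ _ q<v = ⊥-elim (too-high i≤k q<v)
    allowed-next | false | ofⁿ i≰k with v ≤? i
    ... | yes v≤i = ≤⇒≤ᵇ v≤i
    ... | no v≰i  = ⊥-elim (too-far (≰⇒> i≰k) (≰⇒> v≰i))

  laidOut-good : ∀ ps i S → 1 ≤ i → i + length ps ≡ n → All (_< n) ps →
    LaidOut S i → occupiedBelow n S ≤ i → Filled (parkFrom (suc i) ps S) → Avoiding (parkFrom (suc i) ps S) →
    T (allFrom (allowed k) i ps)
  laidOut-good []       i S _   _    _            _  _   _      _        = tt
  laidOut-good (v ∷ ps) i S 1≤i i+≡n (v<n ∷ ps<n) lo occ filled avoiding = Equivalence.from T-∧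
    ( allowed-v
    , laidOut-good ps (suc i) _ (s≤s z≤n) (trans (sym (+-suc i _)) i+≡n) ps<n
        (laidOut-allowed (subst (i <_) i+≡n (m<m+n i z<s)) lo allowed-v)
        (≤-trans (occupiedBelow-place-≤ (suc i) v S n) (s≤s occ)) filled avoiding )
    where allowed-v = Deviation.allowed-next {ps = ps} 1≤i v<n i+≡n lo occ filled avoiding


parkingAvoiding≡good : ∀ {m} (f : Vec (Fin (suc m)) (suc m)) →
  (isParking f ∧ avoidsAll (parkingPerm f) forbidden) ≡ good (prefs f)
parkingAvoiding≡good {m} f@(x ∷ w) = T-ext backward forward
  where
    n = suc m
    k = toℕ x
    open Layout n k (toℕ<n x)

    forward : T (good (prefs f)) → T (isParking f ∧ avoidsAll (parkingPerm f) forbidden)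
    forward ok = Equivalence.from (T-∧ {isParking f})
      ( Equivalence.from (isParking⇔parkingCondition f) (filled⇒parkingCondition n 1 (prefs f) (laidOut-filled lo))
      , subst Avoiding (sym (occupancy≡parkFrom f)) (laidOut-avoiding lo) )
      where
        -- Car 1 is the forced car of step 0: `allowed k 0 k` is `k ≡ᵇ k`.
        lo : LaidOut (parkFrom 1 (prefs f) (empty n)) n
        lo = laidOut-allFrom (prefs f) 0 (empty n) (length-tabulate (toℕ ∘ lookup f)) laidOut-empty
               (Equivalence.from T-∧ (≡⇒≡ᵇ k k refl , ok))

    backward : T (isParking f ∧ avoidsAll (parkingPerm f) forbidden) → T (good (prefs f))
    backward parking∧avoiding =
      laidOut-good (prefs w) 1 (place 1 k (empty n)) (s≤s z≤n) (cong suc (length-tabulate (toℕ ∘ lookup w)))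
        (tabulate⁺ (toℕ<n ∘ lookup w)) (laidOut-forced z≤n laidOut-empty)
        (≤-trans (occupiedBelow-place-≤ 1 k (empty n) n) (s≤s (≤-reflexive (occupiedBelow-empty n n))))
        (parkingCondition⇒filled n 1 (prefs f) (Equivalence.to (isParking⇔parkingCondition f) parking))
        (subst Avoiding (occupancy≡parkFrom f) avoiding)
      where
        parking  = proj₁ (Equivalence.to (T-∧ {isParking f}) parking∧avoiding)
        avoiding = proj₂ (Equivalence.to (T-∧ {isParking f}) parking∧avoiding)

-- Counting admissible preference sequences

count-allVecs-suc : ∀ n m (P : List ℕ → Bool) →
  count (P ∘ prefs) (allVecs n (suc m)) ≡
  sum (map (λ x → count (λ w → P (toℕ x ∷ prefs w)) (allVecs n m)) (allFin n))
count-allVecs-suc n m P = trans (count-concatMap (P ∘ prefs) _ (allFin n))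
  (cong sum (map-cong (λ x → count-map (P ∘ prefs) (x ∷_) (allVecs n m)) (allFin n)))

count-allVecs-allFrom : ∀ n m (p : ℕ → ℕ → Bool) i →
  count (allFrom p i ∘ prefs) (allVecs n (suc m)) ≡
  count (p i ∘ toℕ) (allFin n) * count (allFrom p (suc i) ∘ prefs) (allVecs n m)
count-allVecs-allFrom n m p i = begin
  count (allFrom p i ∘ prefs) (allVecs n (suc m))
    ≡⟨ count-allVecs-suc n m (allFrom p i) ⟩
  sum (map (λ x → count (λ w → p i (toℕ x) ∧ allFrom p (suc i) (prefs w)) (allVecs n m)) (allFin n))
    ≡⟨ cong sum (map-cong (λ x → count-const∧ (p i (toℕ x)) _ (allVecs n m)) (allFin n)) ⟩
  sum (map (λ x → if p i (toℕ x) then count (allFrom p (suc i) ∘ prefs) (allVecs n m) else 0) (allFin n))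
    ≡⟨ sum-indicator (p i ∘ toℕ) _ (allFin n) ⟩
  count (p i ∘ toℕ) (allFin n) * count (allFrom p (suc i) ∘ prefs) (allVecs n m)
    ∎
  where open ≡-Reasoning

count-allFin-suc : ∀ n (p : Fin (suc n) → Bool) →
  count p (allFin (suc n)) ≡ (if p zero then suc (count (p ∘ suc) (allFin n)) else count (p ∘ suc) (allFin n))
count-allFin-suc n p = trans (cong (count p ∘ (zero ∷_)) (sym (map-tabulate (λ i → i) suc)))
  (trans (count-∷ p zero (map suc (allFin n)))
         (cong (λ c → if p zero then suc c else c) (count-map p suc (allFin n))))

count-toℕ≡ : ∀ n a → a < n → count (λ i → toℕ i ≡ᵇ a) (allFin n) ≡ 1
count-toℕ≡ (suc n) zero    _         =
  trans (count-allFin-suc n (λ i → toℕ i ≡ᵇ 0)) (cong suc (count-false (allFin n)))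
count-toℕ≡ (suc n) (suc a) (s≤s a<n) =
  trans (count-allFin-suc n (λ i → toℕ i ≡ᵇ suc a)) (count-toℕ≡ n a a<n)

count-toℕ≤ : ∀ n a → a < n → count (λ i → toℕ i ≤ᵇ a) (allFin n) ≡ suc a
count-toℕ≤ (suc n) zero    _         =
  trans (count-allFin-suc n (λ i → toℕ i ≤ᵇ 0)) (cong suc (count-false (allFin n)))
count-toℕ≤ (suc n) (suc a) (s≤s a<n) = trans (count-allFin-suc n (λ i → toℕ i ≤ᵇ suc a))
  (cong suc (trans (count-cong (λ i → <ᵇ-suc (toℕ i) a) (allFin n)) (count-toℕ≤ n a a<n)))
  where <ᵇ-suc : ∀ m a → (m <ᵇ suc a) ≡ (m ≤ᵇ a)
        <ᵇ-suc zero    a = refl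
        <ᵇ-suc (suc m) a = refl

count-allowed : ∀ n k i → k < n → i < n → count (allowed k i ∘ toℕ) (allFin n) ≡ (if i ≤ᵇ k then 1 else suc i)
count-allowed n k i k<n i<n with i ≤ᵇ k
... | true  = count-toℕ≡ n (k ∸ i) (≤-<-trans (m∸n≤m k i) k<n)
... | false = count-toℕ≤ n i i<n

allowed-factor : ∀ k i N → (if i ≤ᵇ k then 1 else suc i) * N * (i ⊔ suc k) ! ≡ N * (suc i ⊔ suc k) !
allowed-factor k i N with i ≤ᵇ k | ≤ᵇ-reflects-≤ i k
... | true  | ofʸ i≤k = begin
  (N + 0) * (i ⊔ suc k) !   ≡⟨ cong₂ _*_ (+-identityʳ N) (cong _! (m≤n⇒m⊔n≡n (m≤n⇒m≤1+n i≤k))) ⟩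
  N * suc k !               ≡⟨ cong (λ j → N * j !) (m≤n⇒m⊔n≡n (s≤s i≤k)) ⟨
  N * (suc i ⊔ suc k) !     ∎
  where open ≡-Reasoning
... | false | ofⁿ i≰k = begin
  suc i * N * (i ⊔ suc k) ! ≡⟨ cong₂ _*_ (*-comm (suc i) N) (cong _! (m≥n⇒m⊔n≡m (≰⇒> i≰k))) ⟩
  N * suc i * i !           ≡⟨ *-assoc N (suc i) (i !) ⟩
  N * suc i !               ≡⟨ cong (λ j → N * j !) (m≥n⇒m⊔n≡m (s≤s (<⇒≤ (≰⇒> i≰k)))) ⟨
  N * (suc i ⊔ suc k) !     ∎
  where open ≡-Reasoning

-- Car j+1 (i ≤ j < i+m) has j+1 admissible preferences if j > k and one otherwise, so the count
-- is (i+m)!/(i ⊔ (k+1))!.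
count-allowed-allVecs : ∀ n k i m → k < n → i + m ≤ n → k < i + m →
  count (allFrom (allowed k) i ∘ prefs) (allVecs n m) * (i ⊔ suc k) ! ≡ (i + m) !
count-allowed-allVecs n k i zero k<n _ k<i+0 = begin
  1 * (i ⊔ suc k) !  ≡⟨ *-identityˡ _ ⟩
  (i ⊔ suc k) !      ≡⟨ cong _! (m≥n⇒m⊔n≡m (subst (k <_) (+-identityʳ i) k<i+0)) ⟩
  i !                ≡⟨ cong _! (+-identityʳ i) ⟨
  (i + 0) !          ∎
  where open ≡-Reasoning
count-allowed-allVecs n k i (suc m) k<n i+m≤n k<i+m = begin
  count (allFrom (allowed k) i ∘ prefs) (allVecs n (suc m)) * (i ⊔ suc k) !
    ≡⟨ cong (_* (i ⊔ suc k) !) (count-allVecs-allFrom n m (allowed k) i) ⟩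
  count (allowed k i ∘ toℕ) (allFin n) * N * (i ⊔ suc k) !
    ≡⟨ cong (λ c → c * N * (i ⊔ suc k) !) (count-allowed n k i k<n (<-≤-trans (m<m+n i z<s) i+m≤n)) ⟩
  (if i ≤ᵇ k then 1 else suc i) * N * (i ⊔ suc k) !
    ≡⟨ allowed-factor k i N ⟩
  N * (suc i ⊔ suc k) !
    ≡⟨ count-allowed-allVecs n k (suc i) m k<n (subst (_≤ n) (+-suc i m) i+m≤n)
                                                 (subst (k <_) (+-suc i m) k<i+m) ⟩
  (suc i + m) !
    ≡⟨ cong _! (+-suc i m) ⟨
  (i + suc m) !
    ∎
  where open ≡-Reasoning
        N = count (allFrom (allowed k) (suc i) ∘ prefs) (allVecs n m)

count-good-with-first : ∀ m (x : Fin (suc m)) →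
  count (λ w → good (toℕ x ∷ prefs w)) (allVecs (suc m) m) ≡ _/_ (suc m !) (suc (toℕ x) !) {{suc (toℕ x) !≢0}}
count-good-with-first m x = begin
  N                     ≡⟨ m*n/n≡m N (suc k !) ⟨
  N * suc k ! / suc k ! ≡⟨ cong (_/ suc k !) (count-allowed-allVecs (suc m) k 1 m (toℕ<n x) ≤-refl (toℕ<n x)) ⟩
  suc m ! / suc k !     ∎
  where
    open ≡-Reasoning
    k = toℕ x
    N = count (allFrom (allowed k) 1 ∘ prefs) (allVecs (suc m) m)
    instance _ = suc k !≢0

map-allFin : ∀ n (g : ℕ → A) → map (g ∘ toℕ) (allFin n) ≡ map g (upTo n)
map-allFin n g = trans (map-tabulate (λ i → i) (g ∘ toℕ)) (trans (tabulate-toℕ n g) (sym (map-upTo g n)))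
  where
    tabulate-toℕ : ∀ n (g : ℕ → A) → tabulate {n = n} (g ∘ toℕ) ≡ applyUpTo g n
    tabulate-toℕ zero    g = refl
    tabulate-toℕ (suc n) g = cong (g 0 ∷_) (tabulate-toℕ n (g ∘ suc))

mainTheorem20 : (n : ℕ) → n ≥ 1 →
    pk n ((1 ∷ 3 ∷ 2 ∷ []) ∷ (2 ∷ 3 ∷ 1 ∷ []) ∷ (3 ∷ 1 ∷ 2 ∷ []) ∷ []) ≡ sumFactQuot n
mainTheorem20 n@(suc m) _ = begin
  pk n forbidden
    ≡⟨ count-cong parkingAvoiding≡good (allVecs n n) ⟩
  count (good ∘ prefs) (allVecs n n)
    ≡⟨ count-allVecs-suc n m good ⟩
  sum (map (λ x → count (λ w → good (toℕ x ∷ prefs w)) (allVecs n m)) (allFin n))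
    ≡⟨ cong sum (map-cong (count-good-with-first m) (allFin n)) ⟩
  sum (map (λ x → _/_ (n !) (suc (toℕ x) !) {{suc (toℕ x) !≢0}}) (allFin n))
    ≡⟨ cong sum (map-allFin n _) ⟩
  sumFactQuot n
    ∎
  where open ≡-Reasoning
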